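{- Let $w$ be an infinite word beginning with $0$ generated by a morphism. Then the set $X_0$ is generated as an additive group by the set $\{V_x : x \text{ is a return to } 0 \text{ in } w\}$.
   Context: $\Sigma=\{0,\dots,\sigma-1\}$. A morphism $\phi$ is nonerasing; $w$ is generated by $\phi$ if $\phi(0)=0s$ with $s$ nonempty and $w=\lim_n\phi^n(0)$. Parikh vector $V_u=(|u|_0,\dots,|u|_{\sigma-1})$. If $a_0<a_1<\dots$ are the positions of the letter $0$ in $w$, $X_0=\{V_{w[0,a_i)}\}$, and the returns to $0$ are the factors $w[a_i,a_{i+1})$. -}

module Defs where

open import Data.Nat using (ℕ; zero; suc; _+_; _∸_; _<_)
open import Data.Fin using (Fin; zero; suc)
open import Data.Fin.Properties using (_≟_)
open import Data.List using (List; []; _∷_; map; concatMap; upTo; length; lookup)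
open import Data.Vec using (Vec; tabulate; zipWith)
import Data.Vec as V
open import Data.Integer using (ℤ; +_; -_) renaming (_+_ to _+ℤ_)
open import Data.Product using (Σ; _×_; _,_; ∃)
open import Relation.Nullary using (¬_; yes; no)
open import Relation.Binary.PropositionalEquality using (_≡_)

occ : ∀ {σ} → Fin σ → List (Fin σ) → ℕ
occ a [] = 0
occ a (b ∷ u) with a ≟ b
... | yes _ = suc (occ a u)
... | no _  = occ a u

parikh : ∀ {σ} → List (Fin σ) → Vec ℤ σ
parikh u = tabulate (λ a → + occ a u)

factor : ∀ {σ} → (ℕ → Fin σ) → ℕ → ℕ → List (Fin σ)
factor w i j = map (λ t → w (i + t)) (upTo (j ∸ i))

Morphism : ℕ → Set
Morphism σ = Fin σ → List (Fin σ)

NonErasing : ∀ {σ} → Morphism σ → Set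
NonErasing φ = ∀ a → ¬ (φ a ≡ [])

ext : ∀ {σ} → Morphism σ → List (Fin σ) → List (Fin σ)
ext φ = concatMap φ

iter : ∀ {σ} → Morphism σ → ℕ → List (Fin σ) → List (Fin σ)
iter φ zero u = u
iter φ (suc n) u = ext φ (iter φ n u)

IsPrefixOf : ∀ {σ} → List (Fin σ) → (ℕ → Fin σ) → Set
IsPrefixOf u w = ∀ i (p : i < length u) → lookup u (Data.Fin.fromℕ< p) ≡ w i

-- w is generated by φ: φ nonerasing, φ(0) = 0s with s nonempty, and
-- w = lim φ^n(0), i.e. every φ^n(0) is a prefix of w (their lengths tend to ∞,
-- so this determines w).
GeneratedBy : ∀ {k} → Morphism (suc k) → (ℕ → Fin (suc k)) → Set
GeneratedBy {k} φ w =
  NonErasing φ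
  × (Σ (List (Fin (suc k))) λ s → ¬ (s ≡ []) × (φ zero ≡ zero ∷ s))
  × (∀ n → IsPrefixOf (iter φ n (zero ∷ [])) w)

X₀ : ∀ {k} → (ℕ → Fin (suc k)) → Vec ℤ (suc k) → Set
X₀ w v = ∃ λ a → w a ≡ zero × v ≡ parikh (factor w 0 a)

ReturnVec : ∀ {k} → (ℕ → Fin (suc k)) → Vec ℤ (suc k) → Set
ReturnVec w v = ∃ λ a → ∃ λ b →
  a < b × w a ≡ zero × w b ≡ zero
  × (∀ j → a < j → j < b → ¬ (w j ≡ zero))
  × v ≡ parikh (factor w a b)

data InSubgroup {n : ℕ} (S : Vec ℤ n → Set) : Vec ℤ n → Set where
  gen  : ∀ {v} → S v → InSubgroup S v
  zero : InSubgroup S (V.replicate n (+ 0))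
  neg  : ∀ {v} → InSubgroup S v → InSubgroup S (V.map -_ v)
  add  : ∀ {u v} → InSubgroup S u → InSubgroup S v → InSubgroup S (zipWith _+ℤ_ u v)

{-# OPTIONS --safe #-}
-- If w[a,b) is a return to 0, then V_{w[a,b)} = V_{w[0,b)} - V_{w[0,a)} is a difference of
-- elements of X₀. Conversely, if w a = 0 and a > 0, then w[0,a) splits at the last 0
-- before a into a shorter prefix followed by a return, so by induction V_{w[0,a)} is a sum
-- of return vectors.
module Submission where

open import Defs
open import Data.Nat using (ℕ; zero; suc; _+_; _∸_; _<_; _≤_; z≤n; s≤s; s≤s⁻¹)
open import Data.Nat.Properties using (m+[n∸m]≡n; ≤-refl; ≤-trans; m≤n⇒m≤1+n; <⇒≤; ≤∧≢⇒<; <-irrefl)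
import Data.Nat.Properties as ℕ
open import Data.Nat.Induction using (<-rec)
open import Data.Fin using (Fin)
import Data.Fin as F
open import Data.Fin.Properties using (_≟_)
open import Data.List using (List; []; _∷_; _++_; applyUpTo)
open import Data.List.Properties using (map-upTo)
open import Data.Vec using (Vec; tabulate; zipWith; replicate)
import Data.Vec as V
open import Data.Vec.Properties
  using (tabulate-cong; tabulate-∘; map-const; zipWith-comm; zipWith-assoc; zipWith-inverseʳ; zipWith-identityʳ)
open import Data.Integer using (ℤ; +_; -_) renaming (_+_ to _+ℤ_)
import Data.Integer.Properties as ℤ
open import Data.Product using (_×_; _,_; ∃-syntax)
open import Function using (id; const; _∘′_)
open import Function.Bundles using (_⇔_; mk⇔)
open import Relation.Nullary using (¬_; yes; no)
open import Relation.Unary using (Pred; Decidable; _⊆_)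
open import Relation.Binary.PropositionalEquality
open ≡-Reasoning

private
  variable
    σ n : ℕ

infixl 6 _⊕_

_⊕_ : Vec ℤ n → Vec ℤ n → Vec ℤ n
_⊕_ = zipWith _+ℤ_

⊖_ : Vec ℤ n → Vec ℤ n
⊖_ = V.map -_

⊕-⊖-cancelˡ : (u d : Vec ℤ n) → u ⊕ d ⊕ ⊖ u ≡ d
⊕-⊖-cancelˡ {n} u d = begin
  u ⊕ d ⊕ ⊖ u           ≡⟨ cong (_⊕ ⊖ u) (zipWith-comm ℤ.+-comm u d) ⟩
  d ⊕ u ⊕ ⊖ u           ≡⟨ zipWith-assoc ℤ.+-assoc d u (⊖ u) ⟩
  d ⊕ (u ⊕ ⊖ u)         ≡⟨ cong (d ⊕_) (zipWith-inverseʳ ℤ.+-inverseʳ u) ⟩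
  d ⊕ replicate n (+ 0) ≡⟨ zipWith-identityʳ ℤ.+-identityʳ d ⟩
  d                     ∎

zipWith-tabulate : ∀ {A B C : Set} (f : A → B → C) (g : Fin n → A) (h : Fin n → B) →
                   zipWith f (tabulate g) (tabulate h) ≡ tabulate (λ i → f (g i) (h i))
zipWith-tabulate {zero}  f g h = refl
zipWith-tabulate {suc n} f g h =
  cong (f (g F.zero) (h F.zero) V.∷_) (zipWith-tabulate f (g ∘′ F.suc) (h ∘′ F.suc))

applyUpTo-++ : ∀ {A : Set} (f : ℕ → A) m n →
               applyUpTo f (m + n) ≡ applyUpTo f m ++ applyUpTo (λ t → f (m + t)) n
applyUpTo-++ f zero    n = refl
applyUpTo-++ f (suc m) n = cong (f 0 ∷_) (applyUpTo-++ (λ t → f (suc t)) m n)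

occ-++ : (a : Fin σ) (u v : List (Fin σ)) → occ a (u ++ v) ≡ occ a u + occ a v
occ-++ a []      v = refl
occ-++ a (b ∷ u) v with a ≟ b
... | yes _ = cong suc (occ-++ a u v)
... | no _  = occ-++ a u v

parikh-[] : parikh {σ} [] ≡ replicate σ (+ 0)
parikh-[] = trans (tabulate-∘ (const (+ 0)) id) (map-const _ (+ 0))

parikh-++ : (u v : List (Fin σ)) → parikh (u ++ v) ≡ parikh u ⊕ parikh v
parikh-++ u v = begin
  parikh (u ++ v)                         ≡⟨ tabulate-cong (λ a → cong +_ (occ-++ a u v)) ⟩
  tabulate (λ a → + occ a u +ℤ + occ a v) ≡⟨ zipWith-tabulate _+ℤ_ _ _ ⟨
  parikh u ⊕ parikh v                     ∎

factor-split : (w : ℕ → Fin σ) {i j : ℕ} → i ≤ j → factor w 0 j ≡ factor w 0 i ++ factor w i j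
factor-split w {i} {j} i≤j = begin
  factor w 0 j                                   ≡⟨ map-upTo w j ⟩
  applyUpTo w j                                  ≡⟨ cong (applyUpTo w) (m+[n∸m]≡n i≤j) ⟨
  applyUpTo w (i + (j ∸ i))                      ≡⟨ applyUpTo-++ w i (j ∸ i) ⟩
  applyUpTo w i ++ applyUpTo (λ t → w (i + t)) (j ∸ i)
    ≡⟨ cong₂ _++_ (map-upTo w i) (map-upTo (λ t → w (i + t)) (j ∸ i)) ⟨
  factor w 0 i ++ factor w i j                   ∎

parikh-factor-split : (w : ℕ → Fin σ) {i j : ℕ} → i ≤ j →
                      parikh (factor w 0 j) ≡ parikh (factor w 0 i) ⊕ parikh (factor w i j)
parikh-factor-split w {i} {j} i≤j =
  trans (cong parikh (factor-split w i≤j)) (parikh-++ (factor w 0 i) (factor w i j))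

parikh-factor≡difference : (w : ℕ → Fin σ) {i j : ℕ} → i ≤ j →
                           parikh (factor w i j) ≡ parikh (factor w 0 j) ⊕ ⊖ parikh (factor w 0 i)
parikh-factor≡difference w {i} {j} i≤j = begin
  parikh (factor w i j)                                          ≡⟨ ⊕-⊖-cancelˡ _ _ ⟨
  parikh (factor w 0 i) ⊕ parikh (factor w i j) ⊕ ⊖ parikh (factor w 0 i)
    ≡⟨ cong (_⊕ ⊖ parikh (factor w 0 i)) (parikh-factor-split w i≤j) ⟨
  parikh (factor w 0 j) ⊕ ⊖ parikh (factor w 0 i)                ∎

last-≤ : ∀ {p} {P : Pred ℕ p} → Decidable P → P 0 →
         ∀ n → ∃[ b ] b ≤ n × P b × (∀ j → b < j → j ≤ n → ¬ P j)
last-≤ P? P0 zero = 0 , z≤n , P0 , λ { j (s≤s _) () }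
last-≤ {P = P} P? P0 (suc n) with P? (suc n) | last-≤ P? P0 n
... | yes Psn | _ = suc n , ≤-refl , Psn , λ j sn<j j≤sn _ → <-irrefl refl (≤-trans sn<j j≤sn)
... | no ¬Psn | b , b≤n , Pb , gap = b , m≤n⇒m≤1+n b≤n , Pb , gap′
  where
  gap′ : ∀ j → b < j → j ≤ suc n → ¬ P j
  gap′ j b<j j≤sn with j ℕ.≟ suc n
  ... | yes refl = ¬Psn
  ... | no j≢sn  = gap j b<j (s≤s⁻¹ (≤∧≢⇒< j≤sn j≢sn))

InSubgroup-⊆ : {S T : Vec ℤ n → Set} → S ⊆ InSubgroup T → InSubgroup S ⊆ InSubgroup T
InSubgroup-⊆ S⊆T (gen s)   = S⊆T s
InSubgroup-⊆ S⊆T zero      = zero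
InSubgroup-⊆ S⊆T (neg p)   = neg (InSubgroup-⊆ S⊆T p)
InSubgroup-⊆ S⊆T (add p q) = add (InSubgroup-⊆ S⊆T p) (InSubgroup-⊆ S⊆T q)

module _ {k} (w : ℕ → Fin (suc k)) where

  ReturnVec⊆⟨X₀⟩ : ReturnVec w ⊆ InSubgroup (X₀ w)
  ReturnVec⊆⟨X₀⟩ (a , b , a<b , wa , wb , _ , refl) =
    subst (InSubgroup (X₀ w)) (sym (parikh-factor≡difference w (<⇒≤ a<b)))
      (add (gen (b , wb , refl)) (neg (gen (a , wa , refl))))

  prefix-parikh∈⟨ReturnVec⟩ : w 0 ≡ F.zero →
    ∀ a → w a ≡ F.zero → InSubgroup (ReturnVec w) (parikh (factor w 0 a))
  prefix-parikh∈⟨ReturnVec⟩ w0 = <-rec _ step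
    where
    step : ∀ a → (∀ {b} → b < a → w b ≡ F.zero → InSubgroup (ReturnVec w) (parikh (factor w 0 b))) →
           w a ≡ F.zero → InSubgroup (ReturnVec w) (parikh (factor w 0 a))
    step zero    _  _  = subst (InSubgroup (ReturnVec w)) (sym parikh-[]) zero
    step (suc n) IH wa with last-≤ (λ j → w j ≟ F.zero) w0 n
    ... | b , b≤n , wb , gap =
      subst (InSubgroup (ReturnVec w)) (sym (parikh-factor-split w (m≤n⇒m≤1+n b≤n)))
        (add (IH (s≤s b≤n) wb) (gen (b , suc n , s≤s b≤n , wb , wa , gap′ , refl)))
      where
      gap′ : ∀ j → b < j → j < suc n → ¬ w j ≡ F.zero
      gap′ j b<j j<sn = gap j b<j (s≤s⁻¹ j<sn)

  X₀⊆⟨ReturnVec⟩ : w 0 ≡ F.zero → X₀ w ⊆ InSubgroup (ReturnVec w)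
  X₀⊆⟨ReturnVec⟩ w0 (a , wa , refl) = prefix-parikh∈⟨ReturnVec⟩ w0 a wa

lemma3 : ∀ {k} (φ : Morphism (suc k)) (w : ℕ → Fin (suc k)) →
         GeneratedBy φ w →
         (∀ v → InSubgroup (X₀ w) v ⇔ InSubgroup (ReturnVec w) v)
lemma3 φ w (_ , _ , iterates-are-prefixes) v =
  mk⇔ (InSubgroup-⊆ (X₀⊆⟨ReturnVec⟩ w w0)) (InSubgroup-⊆ (ReturnVec⊆⟨X₀⟩ w))
  where
  w0 : w 0 ≡ F.zero
  w0 = sym (iterates-are-prefixes 0 0 (s≤s z≤n))
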